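{- The following graphs are midpoint unit veto interval (MUVI) graphs: (1) the complete bipartite graphs $K_{m,n}$ for all $m\ge1$, $n\ge1$; (2) all caterpillars; (3) the cycles $C_n$ for all $n \geq 4$.
   Context: All graphs are finite and simple. A caterpillar is a tree containing a path $s_1s_2\cdots s_k$ (the spine) such that every vertex has distance at most one from the spine. A veto interval is a triple $I(a)=(a_l,a_v,a_r)$ of reals with $a_l<a_v<a_r$. A veto interval representation of a graph $G$ assigns to each vertex $a$ a veto interval $I(a)$ such that distinct vertices $a,b$ are adjacent if and only if $a_v<b_l<a_r<b_v$ or $b_v<a_l<b_r<a_v$. It is midpoint unit if all intervals $[a_l,a_r]$ have the same length and every veto mark is the midpoint, $a_v=(a_l+a_r)/2$. A MUVI graph is a graph with a midpoint unit veto interval representation. -}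

module Defs where

open import Level using (0ℓ)
open import Data.Nat as ℕ using (ℕ; zero; suc; _+_)
open import Data.Nat.Properties using (≤⇒≯; 1+n≢n)
open import Data.Fin using (Fin; toℕ)
open import Data.Rational as ℚ using (ℚ; ½)
open import Data.Product using (Σ; ∃; _×_; _,_)
open import Data.Sum using (_⊎_; inj₁; inj₂)
open import Data.List using (List; []; _∷_; _++_; take; length)
open import Data.List.Membership.Propositional using (_∈_)
open import Data.List.Relation.Unary.Any using (Any)
open import Data.List.Relation.Unary.Linked using (Linked)
open import Data.List.Relation.Unary.Unique.Propositional using (Unique)
open import Relation.Binary.Construct.Closure.ReflexiveTransitive using (Star)
open import Relation.Binary.PropositionalEquality using (_≡_; _≢_; refl; sym; trans)
open import Relation.Nullary using (¬_)
open import Function.Bundles using (_⇔_)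

record Graph : Set₁ where
  field
    size   : ℕ
    Adj    : Fin size → Fin size → Set
    adj-sym    : ∀ {x y} → Adj x y → Adj y x
    adj-irrefl : ∀ {x} → ¬ Adj x x

open Graph public

record VetoInterval : Set where
  field
    l v r : ℚ
    l<v : l ℚ.< v
    v<r : v ℚ.< r

open VetoInterval public

VetoRelated : VetoInterval → VetoInterval → Set
VetoRelated A B =
  (v A ℚ.< l B × l B ℚ.< r A × r A ℚ.< v B) ⊎
  (v B ℚ.< l A × l A ℚ.< r B × r B ℚ.< v A)

IsVetoRep : (G : Graph) → (Fin (size G) → VetoInterval) → Set
IsVetoRep G I = ∀ a b → a ≢ b → (Adj G a b ⇔ VetoRelated (I a) (I b))

IsMidpointUnit : {n : ℕ} → (Fin n → VetoInterval) → Set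
IsMidpointUnit I =
  (∀ a b → r (I a) ℚ.- l (I a) ≡ r (I b) ℚ.- l (I b)) ×
  (∀ a → v (I a) ≡ ½ ℚ.* (l (I a) ℚ.+ r (I a)))

MUVI : Graph → Set
MUVI G = Σ (Fin (size G) → VetoInterval) λ I → IsVetoRep G I × IsMidpointUnit I

KAdj : (m n : ℕ) → Fin (m + n) → Fin (m + n) → Set
KAdj m n x y = (toℕ x ℕ.< m × m ℕ.≤ toℕ y) ⊎ (toℕ y ℕ.< m × m ℕ.≤ toℕ x)

K : ℕ → ℕ → Graph
K m n = record
  { size = m + n
  ; Adj = KAdj m n
  ; adj-sym = λ { (inj₁ p) → inj₂ p ; (inj₂ p) → inj₁ p }
  ; adj-irrefl = λ { (inj₁ (p , q)) → ≤⇒≯ q p ; (inj₂ (p , q)) → ≤⇒≯ q p }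
  }

CAdj : (n : ℕ) → Fin n → Fin n → Set
CAdj n x y =
  toℕ y ≡ suc (toℕ x) ⊎ toℕ x ≡ suc (toℕ y) ⊎
  (toℕ x ≡ 0 × suc (toℕ y) ≡ n) ⊎ (toℕ y ≡ 0 × suc (toℕ x) ≡ n)

private
  1≢3+ : ∀ k → suc zero ≢ 3 + k
  1≢3+ k ()

C : (n : ℕ) → 3 ℕ.≤ n → Graph
C n h = record
  { size = n
  ; Adj = CAdj n
  ; adj-sym = λ { (inj₁ p) → inj₂ (inj₁ p)
                ; (inj₂ (inj₁ p)) → inj₁ p
                ; (inj₂ (inj₂ (inj₁ p))) → inj₂ (inj₂ (inj₂ p))
                ; (inj₂ (inj₂ (inj₂ p))) → inj₂ (inj₂ (inj₁ p)) }
  ; adj-irrefl = irr h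
  }
  where
  irr : 3 ℕ.≤ n → ∀ {x} → ¬ CAdj n x x
  irr _ (inj₁ p) = 1+n≢n (sym p)
  irr _ (inj₂ (inj₁ p)) = 1+n≢n (sym p)
  irr (ℕ.s≤s (ℕ.s≤s (ℕ.s≤s _))) {x} (inj₂ (inj₂ (inj₁ (p , q)))) with toℕ x
  ... | zero = 1≢3+ _ q
  irr (ℕ.s≤s (ℕ.s≤s (ℕ.s≤s _))) {x} (inj₂ (inj₂ (inj₂ (p , q)))) with toℕ x
  ... | zero = 1≢3+ _ q

module _ (G : Graph) where
  private V = Fin (size G)

  IsPath : List V → Set
  IsPath xs = Linked (Adj G) xs × Unique xs

  IsCycle : List V → Set
  IsCycle xs = 3 ℕ.≤ length xs × Unique xs × Linked (Adj G) (xs ++ take 1 xs)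

  Connected : Set
  Connected = ∀ x y → Star (Adj G) x y

  Acyclic : Set
  Acyclic = ∀ xs → ¬ IsCycle xs

  IsTree : Set
  IsTree = Connected × Acyclic

  IsSpine : List V → Set
  IsSpine s = IsPath s × (∀ x → x ∈ s ⊎ Any (Adj G x) s)

  IsCaterpillar : Set
  IsCaterpillar = IsTree × ∃ IsSpine

-- Place each vertex at a natural number p and give it the veto interval [p, p + 16] with
-- mark p + 8. Two such intervals are veto-related exactly when their positions differ by
-- strictly between 8 and 16, so it suffices to lay the vertices out on ℕ with adjacency
-- meaning "distance in (8, 16)". For K_{m,n} the two parts go to 0 and 12. For a caterpillar
-- the spine goes along 13 + 10i and each leaf 13 away from its spine vertex, on alternating
-- sides; acyclicity shows that the spine has no chords, that a leaf sees only one spine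
-- vertex and that no two leaves are adjacent, matching the layout. For a cycle the vertices
-- go out along one track of step 12, turn, come back along a second track interleaved with
-- the first at offset 6 (so the tracks never interact), and the last vertex at 0 closes
-- the cycle.
module Submission where

open import Defs
open import Data.Nat
  using (ℕ; zero; suc; _+_; _*_; _≤_; _<_; z≤n; s≤s; z<s; s<s; s<s⁻¹; ∣_-_∣; _<?_; _≤?_)
open import Data.Nat.Properties
open import Data.Nat.Coprimality as Coprime using ()
open import Data.Integer as ℤ using (+_; +<+)
import Data.Integer.Properties as ℤ
open import Data.Rational as ℚ using (ℚ; mkℚ; ½; *<*)
import Data.Rational.Properties as ℚ
import Data.Rational.Unnormalised as ℚᵘ
import Data.Rational.Unnormalised.Properties as ℚᵘ
open import Data.Rational.Solver using (module +-*-Solver)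
open import Data.Fin using (Fin; toℕ)
open import Data.Fin.Properties using (toℕ<n; toℕ-injective) renaming (_≟_ to _≟ᶠ_)
open import Data.List using (List; []; _∷_; _++_; length)
open import Data.List.Relation.Unary.Any as Any using (Any; here; there)
open import Data.List.Relation.Unary.All using (All; []; _∷_)
open import Data.List.Relation.Unary.All.Properties using (anti-mono)
open import Data.List.Relation.Unary.Linked as Linked using (Linked; [-]; _∷_)
open import Data.List.Relation.Unary.AllPairs using ([]; _∷_)
open import Data.List.Relation.Unary.Unique.Propositional using (Unique)
open import Data.List.Membership.Propositional using (_∈_; _∉_; find)
import Data.List.Membership.Setoid.Properties as Membership
open import Data.List.Relation.Binary.Subset.Propositional using (_⊆_)
open import Data.Product using (_×_; _,_; proj₁; proj₂; ∃₂)
open import Data.Sum as Sum using (_⊎_; inj₁; inj₂; [_,_])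
open import Data.Empty using (⊥-elim)
open import Function using (id; _∘_)
open import Function.Bundles using (_⇔_; mk⇔; Equivalence)
open import Function.Properties.Equivalence
  using (⇔-setoid) renaming (trans to ⇔-trans; sym to ⇔-sym)
open import Level using (0ℓ)
import Relation.Binary.Reasoning.Setoid as SetoidReasoning
open import Relation.Nullary using (¬_; Dec; yes; no)
open import Relation.Nullary.Decidable using (_×-dec_; from-yes; from-no)
open import Relation.Binary.Definitions using (Symmetric; tri<; tri≈; tri>)
open import Relation.Binary.PropositionalEquality
  using (_≡_; _≢_; refl; sym; trans; cong; cong₂; subst; subst₂; setoid; module ≡-Reasoning)

module ⇔-Reasoning = SetoidReasoning (⇔-setoid 0ℓ)

both⇔ : ∀ {A B : Set} → A → B → A ⇔ B
both⇔ a b = mk⇔ (λ _ → b) (λ _ → a)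

neither⇔ : ∀ {A B : Set} → ¬ A → ¬ B → A ⇔ B
neither⇔ ¬a ¬b = mk⇔ (⊥-elim ∘ ¬a) (⊥-elim ∘ ¬b)

InBand : ℕ → Set
InBand d = 8 < d × d < 16

inBand? : ∀ d → Dec (InBand d)
inBand? d = (8 <? d) ×-dec (d <? 16)

¬inBand-≥16 : ∀ {d} → 16 ≤ d → ¬ InBand d
¬inBand-≥16 16≤d (_ , d<16) = <⇒≱ d<16 16≤d

¬inBand-16+ : ∀ {d} → ¬ InBand (16 + d)
¬inBand-16+ {d} = ¬inBand-≥16 (m≤m+n 16 d)

inBand-*⇔≡1 : ∀ {s} → InBand s → ∀ d → InBand (d * s) ⇔ d ≡ 1
inBand-*⇔≡1 _ zero = neither⇔ (λ ()) (λ ())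
inBand-*⇔≡1 {s} s∈ 1 = both⇔ (subst InBand (sym (*-identityˡ s)) s∈) refl
inBand-*⇔≡1 {s} (8<s , _) (suc (suc d)) = neither⇔ (¬inBand-≥16 16≤s+s) (λ ())
  where
  16≤s+s : 16 ≤ s + (s + d * s)
  16≤s+s = +-mono-≤ (<⇒≤ 8<s) (≤-trans (<⇒≤ 8<s) (m≤m+n s (d * s)))

Band : ℕ → ℕ → Set
Band a b = InBand ∣ a - b ∣

band? : ∀ a b → Dec (Band a b)
band? a b = inBand? ∣ a - b ∣

band-sym : ∀ {a b} → Band a b → Band b a
band-sym {a} {b} = subst InBand (∣-∣-comm a b)

band-sym⇔ : ∀ a b → Band a b ⇔ Band b a
band-sym⇔ a b = mk⇔ (band-sym {a}) (band-sym {b})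

band-progression : ∀ {s} → InBand s → ∀ c m n → Band (c + m * s) (c + n * s) ⇔ ∣ m - n ∣ ≡ 1
band-progression {s} s∈ c m n = subst (_⇔ _) (cong InBand distance) (inBand-*⇔≡1 s∈ ∣ m - n ∣)
  where
  distance : ∣ m - n ∣ * s ≡ ∣ c + m * s - c + n * s ∣
  distance = trans (*-distribʳ-∣-∣ s m n) (sym (∣m+n-m+o∣≡∣n-o∣ c (m * s) (n * s)))

-- a_v < b_l < a_r for the intervals [a, a + 16] and [b, b + 16] with midpoint marks;
-- the remaining condition a_r < b_v of the veto relation then holds automatically.
Overlap : ℕ → ℕ → Set
Overlap a b = a + 8 < b × b < a + 16

overlap⇔band : ∀ a b → (Overlap a b ⊎ Overlap b a) ⇔ Band a b
overlap⇔band zero    zero    = mk⇔ (λ { (inj₁ (() , _)) ; (inj₂ (() , _)) }) inj₁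
overlap⇔band zero    (suc b) = mk⇔ (λ { (inj₁ o) → o ; (inj₂ (() , _)) }) inj₁
overlap⇔band (suc a) zero    = mk⇔ (λ { (inj₁ (() , _)) ; (inj₂ o) → o }) inj₂
overlap⇔band (suc a) (suc b) =
  ⇔-trans (mk⇔ (Sum.map shrink shrink) (Sum.map grow grow)) (overlap⇔band a b)
  where
  shrink : ∀ {x y} → Overlap (suc x) (suc y) → Overlap x y
  shrink (p , q) = s<s⁻¹ p , s<s⁻¹ q
  grow : ∀ {x y} → Overlap x y → Overlap (suc x) (suc y)
  grow (p , q) = s<s p , s<s q

toℚ : ℕ → ℚ
toℚ n = mkℚ (+ n) 0 (Coprime.sym (Coprime.1-coprimeTo n))

toℚ-+ : ∀ m n → toℚ (m + n) ≡ toℚ m ℚ.+ toℚ n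
toℚ-+ m n = ℚ.toℚᵘ-injective
  (ℚᵘ.≃-trans (ℚᵘ.*≡* numerators) (ℚᵘ.≃-sym (ℚ.toℚᵘ-homo-+ (toℚ m) (toℚ n))))
  where
  numerators : + (m + n) ℤ.* + 1 ≡ (+ m ℤ.* + 1 ℤ.+ + n ℤ.* + 1) ℤ.* + 1
  numerators = begin
    + (m + n) ℤ.* + 1             ≡⟨ ℤ.*-identityʳ _ ⟩
    + m ℤ.+ + n                   ≡⟨ sym (cong₂ ℤ._+_ (ℤ.*-identityʳ (+ m)) (ℤ.*-identityʳ (+ n))) ⟩
    + m ℤ.* + 1 ℤ.+ + n ℤ.* + 1   ≡⟨ sym (ℤ.*-identityʳ _) ⟩
    (+ m ℤ.* + 1 ℤ.+ + n ℤ.* + 1) ℤ.* + 1 ∎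
    where open ≡-Reasoning

toℚ-mono-< : ∀ {m n} → m < n → toℚ m ℚ.< toℚ n
toℚ-mono-< {m} {n} m<n =
  *<* (subst₂ ℤ._<_ (sym (ℤ.*-identityʳ (+ m))) (sym (ℤ.*-identityʳ (+ n))) (+<+ m<n))

toℚ-cancel-< : ∀ {m n} → toℚ m ℚ.< toℚ n → m < n
toℚ-cancel-< {m} {n} (*<* m<n) =
  ℤ.drop‿+<+ (subst₂ ℤ._<_ (ℤ.*-identityʳ (+ m)) (ℤ.*-identityʳ (+ n)) m<n)

vetoInterval : ℕ → VetoInterval
vetoInterval a = record
  { l = toℚ a ; v = toℚ (a + 8) ; r = toℚ (a + 16)
  ; l<v = toℚ-mono-< (m<m+n a z<s)
  ; v<r = toℚ-mono-< (+-monoʳ-< a (m<m+n 8 z<s))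
  }

vetoInterval-isMidpointUnit : ∀ {n} (p : Fin n → ℕ) → IsMidpointUnit (vetoInterval ∘ p)
vetoInterval-isMidpointUnit p = (λ a b → trans (width (p a)) (sym (width (p b)))) , midpoint ∘ p
  where
  open +-*-Solver
  width : ∀ a → toℚ (a + 16) ℚ.- toℚ a ≡ toℚ 16
  width a = trans (cong (ℚ._- toℚ a) (toℚ-+ a 16))
                   (solve 2 (λ x c → (x :+ c) :- x := c) refl (toℚ a) (toℚ 16))
  midpoint : ∀ a → toℚ (a + 8) ≡ ½ ℚ.* (toℚ a ℚ.+ toℚ (a + 16))
  midpoint a = begin
    toℚ (a + 8)                          ≡⟨ toℚ-+ a 8 ⟩
    toℚ a ℚ.+ toℚ 8                      ≡⟨ solve 1 (λ x → x :+ con (toℚ 8) := con ½ :* (x :+ (x :+ con (toℚ 16))))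
                                                    refl (toℚ a) ⟩
    ½ ℚ.* (toℚ a ℚ.+ (toℚ a ℚ.+ toℚ 16)) ≡⟨ cong (λ z → ½ ℚ.* (toℚ a ℚ.+ z)) (toℚ-+ a 16) ⟨
    ½ ℚ.* (toℚ a ℚ.+ toℚ (a + 16))       ∎
    where open ≡-Reasoning

vetoRelated⇔band : ∀ a b → VetoRelated (vetoInterval a) (vetoInterval b) ⇔ Band a b
vetoRelated⇔band a b =
  ⇔-trans (mk⇔ (Sum.map reflect reflect) (Sum.map embed embed)) (overlap⇔band a b)
  where
  VetoBefore : ℕ → ℕ → Set
  VetoBefore x y = toℚ (x + 8) ℚ.< toℚ y × toℚ y ℚ.< toℚ (x + 16) × toℚ (x + 16) ℚ.< toℚ (y + 8)
  reflect : ∀ {x y} → VetoBefore x y → Overlap x y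
  reflect (p , q , _) = toℚ-cancel-< p , toℚ-cancel-< q
  embed : ∀ {x y} → Overlap x y → VetoBefore x y
  embed {x} {y} (p , q) =
    toℚ-mono-< p , toℚ-mono-< q , toℚ-mono-< (subst (_< y + 8) (+-assoc x 8 8) (+-monoˡ-< 8 p))

muvi-fromBandLayout : (G : Graph) (p : Fin (size G) → ℕ) →
                      (∀ a b → a ≢ b → Adj G a b ⇔ Band (p a) (p b)) → MUVI G
muvi-fromBandLayout G p adj⇔band =
  vetoInterval ∘ p ,
  (λ a b a≢b → ⇔-trans (adj⇔band a b a≢b) (⇔-sym (vetoRelated⇔band (p a) (p b)))) ,
  vetoInterval-isMidpointUnit p

-- Complete bipartite graphs

partPos : ∀ m {n} → Fin (m + n) → ℕ
partPos m x with toℕ x <? m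
... | yes _ = 0
... | no  _ = 12

completeBipartite-muvi : ∀ m n → MUVI (K m n)
completeBipartite-muvi m n = muvi-fromBandLayout (K m n) (partPos m) (λ x y _ → kAdj⇔band x y)
  where
  kAdj⇔band : ∀ x y → KAdj m n x y ⇔ Band (partPos m x) (partPos m y)
  kAdj⇔band x y with toℕ x <? m | toℕ y <? m
  ... | yes x<m | yes y<m = neither⇔ [ <⇒≱ y<m ∘ proj₂ , <⇒≱ x<m ∘ proj₂ ] (from-no (band? 0 0))
  ... | yes x<m | no  y≮m = both⇔ (inj₁ (x<m , ≮⇒≥ y≮m)) (from-yes (band? 0 12))
  ... | no  x≮m | yes y<m = both⇔ (inj₂ (y<m , ≮⇒≥ x≮m)) (from-yes (band? 12 0))
  ... | no  x≮m | no  y≮m = neither⇔ [ x≮m ∘ proj₁ , y≮m ∘ proj₁ ] (from-no (band? 12 12))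

-- Caterpillars

spinePos : ℕ → ℕ
spinePos i = 13 + i * 10

-- Leaves hang 13 above (even i) or 13 below (odd i) their spine vertex, so the leaves of
-- consecutive spine vertices end up 16 apart.
leafPos : ℕ → ℕ
leafPos 0 = 26
leafPos 1 = 10
leafPos (suc (suc i)) = 20 + leafPos i

10≤leafPos : ∀ i → 10 ≤ leafPos i
10≤leafPos 0 = m≤m+n 10 16
10≤leafPos 1 = ≤-refl
10≤leafPos (suc (suc i)) = ≤-trans (10≤leafPos i) (m≤n+m (leafPos i) 20)

¬inBand-6+c+leafPos : ∀ c i → ¬ InBand (6 + c + leafPos i)
¬inBand-6+c+leafPos c i = ¬inBand-≥16 (+-mono-≤ (m≤m+n 6 c) (10≤leafPos i))

spine-band : ∀ i j → Band (spinePos i) (spinePos j) ⇔ ∣ i - j ∣ ≡ 1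
spine-band = band-progression (from-yes (inBand? 10)) 13

leaf-spine-band : ∀ i j → Band (leafPos i) (spinePos j) ⇔ i ≡ j
leaf-spine-band 0 0 = both⇔ (from-yes (band? 26 13)) refl
leaf-spine-band 0 1 = neither⇔ (from-no (band? 26 23)) (λ ())
leaf-spine-band 0 2 = neither⇔ (from-no (band? 26 33)) (λ ())
leaf-spine-band 0 (suc (suc (suc j))) = neither⇔ ¬inBand-16+ (λ ())
leaf-spine-band 1 0 = neither⇔ (from-no (band? 10 13)) (λ ())
leaf-spine-band 1 1 = both⇔ (from-yes (band? 10 23)) refl
leaf-spine-band 1 (suc (suc j)) = neither⇔ ¬inBand-16+ (λ ())
leaf-spine-band (suc (suc i)) 0 = neither⇔ (¬inBand-6+c+leafPos 1 i) (λ ())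
leaf-spine-band 2 1 = neither⇔ (from-no (band? 46 23)) (λ ())
leaf-spine-band 3 1 = neither⇔ (from-no (band? 30 23)) (λ ())
leaf-spine-band (suc (suc (suc (suc i)))) 1 = neither⇔ (¬inBand-6+c+leafPos 11 i) (λ ())
leaf-spine-band (suc (suc i)) (suc (suc j)) =
  ⇔-trans (leaf-spine-band i j) (mk⇔ (cong (suc ∘ suc)) (suc-injective ∘ suc-injective))

¬band-26-leafPos : ∀ j → ¬ Band 26 (leafPos j)
¬band-26-leafPos 0 = from-no (band? 26 26)
¬band-26-leafPos 1 = from-no (band? 26 10)
¬band-26-leafPos 2 = from-no (band? 26 46)
¬band-26-leafPos 3 = from-no (band? 26 30)
¬band-26-leafPos (suc (suc (suc (suc j)))) = ¬inBand-6+c+leafPos 8 j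

¬band-10-leafPos : ∀ j → ¬ Band 10 (leafPos j)
¬band-10-leafPos 0 = from-no (band? 10 26)
¬band-10-leafPos 1 = from-no (band? 10 10)
¬band-10-leafPos (suc (suc j)) = ¬inBand-6+c+leafPos 4 j

¬leaf-leaf-band : ∀ i j → ¬ Band (leafPos i) (leafPos j)
¬leaf-leaf-band 0 j = ¬band-26-leafPos j
¬leaf-leaf-band 1 j = ¬band-10-leafPos j
¬leaf-leaf-band (suc (suc i)) 0 = ¬band-26-leafPos (2 + i) ∘ band-sym {leafPos (2 + i)} {26}
¬leaf-leaf-band (suc (suc i)) 1 = ¬band-10-leafPos (2 + i) ∘ band-sym {leafPos (2 + i)} {10}
¬leaf-leaf-band (suc (suc i)) (suc (suc j)) = ¬leaf-leaf-band i j

gap≡distance : ∀ {m n d} → m + d ≡ n → d ≡ ∣ m - n ∣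
gap≡distance {m} {d = d} eq = trans (sym (∣m-m+n∣≡n m d)) (cong ∣ m -_∣ eq)

module _ (G : Graph) where
  private
    V : Set
    V = Fin (size G)

  idx : ∀ {x : V} {s} → x ∈ s → ℕ
  idx = toℕ ∘ Any.index

  idx-injective : ∀ {x y : V} {s} (p : x ∈ s) (q : y ∈ s) → idx p ≡ idx q → x ≡ y
  idx-injective p q = Membership.index-injective (setoid V) p q ∘ toℕ-injective

  adj-sym⇔ : ∀ {x y} → Adj G x y ⇔ Adj G y x
  adj-sym⇔ = mk⇔ (adj-sym G) (adj-sym G)

  data Walk : V → V → List V → Set where
    end : ∀ {a} → Walk a a []
    _∷_ : ∀ {a b c xs} → Adj G a b → Walk b c xs → Walk a c (b ∷ xs)

  walk-step : ∀ {a b xs} → Walk a b xs → length xs ≡ 1 → Adj G a b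
  walk-step (ab ∷ end) _ = ab

  closeWalk : ∀ {a b c xs} → Walk a b xs → Adj G b c → Linked (Adj G) (a ∷ xs ++ c ∷ [])
  closeWalk end         bc = bc ∷ [-]
  closeWalk (ab ∷ walk) bc = ab ∷ closeWalk walk bc

  acyclic⇒¬closingEdge : Acyclic G → ∀ {a b xs} → Walk a b xs → Unique (a ∷ xs) →
                         2 ≤ length xs → ¬ Adj G b a
  acyclic⇒¬closingEdge acyclic walk unique 2≤∣xs∣ ba =
    acyclic _ (s≤s 2≤∣xs∣ , unique , closeWalk walk ba)

  record Segment (x y : V) (s : List V) (d : ℕ) : Set where
    field
      {inner} : List V
      walk    : Walk x y inner
      unique  : Unique (x ∷ inner)
      ⊆path   : x ∷ inner ⊆ s
      length≡ : length inner ≡ d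
  open Segment

  segment : ∀ {s x y d} → Linked (Adj G) s → Unique s → (p : x ∈ s) (q : y ∈ s) →
            idx p + d ≡ idx q → Segment x y s d
  segment _ _ (here refl) (here refl) refl = record
    { walk = end ; unique = [] ∷ [] ; ⊆path = λ { (here refl) → here refl } ; length≡ = refl }
  segment [-] _ (here refl) (there ()) _
  segment (xz ∷ linked) (x∉ ∷ unique) (here refl) (there q) refl =
    let seg = segment linked unique (here refl) q refl in record
    { walk = xz ∷ walk seg
    ; unique = anti-mono (⊆path seg) x∉ ∷ Segment.unique seg
    ; ⊆path = λ { (here refl) → here refl ; (there m) → there (⊆path seg m) }
    ; length≡ = cong suc (length≡ seg)
    }
  segment linked (_ ∷ unique) (there p) (there q) eq =
    let seg = segment (Linked.tail linked) unique p q (suc-injective eq) in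
    record
    { walk = walk seg ; unique = Segment.unique seg ; ⊆path = there ∘ ⊆path seg ; length≡ = length≡ seg }

  data Placement (s : List V) (x : V) : Set where
    onSpine : x ∈ s → Placement s x
    leafOf  : ∀ {y} → x ∉ s → y ∈ s → Adj G x y → Placement s x

  placement : ∀ {s} → (∀ x → x ∈ s ⊎ Any (Adj G x) s) → ∀ x → Placement s x
  placement {s} cover x with Any.any? (x ≟ᶠ_) s
  ... | yes x∈s = onSpine x∈s
  ... | no x∉s with cover x
  ...   | inj₁ x∈s      = ⊥-elim (x∉s x∈s)
  ...   | inj₂ adjacent = let _ , y∈s , xy = find adjacent in leafOf x∉s y∈s xy

  placementPos : ∀ {s x} → Placement s x → ℕ
  placementPos (onSpine p)    = spinePos (idx p)
  placementPos (leafOf _ q _) = leafPos (idx q)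

  module _ (acyclic : Acyclic G) {s} (linked : Linked (Adj G) s) (unique : Unique s) where

    adj⇔gap≡1 : ∀ {x y d} (p : x ∈ s) (q : y ∈ s) → idx p + d ≡ idx q → Adj G x y ⇔ d ≡ 1
    adj⇔gap≡1 {d = 0} p q eq with idx-injective p q (trans (sym (+-identityʳ _)) eq)
    ... | refl = neither⇔ (adj-irrefl G) (λ ())
    adj⇔gap≡1 {d = 1} p q eq =
      let seg = segment linked unique p q eq in
      both⇔ (walk-step (walk seg) (length≡ seg)) refl
    adj⇔gap≡1 {d = suc (suc d)} p q eq =
      let seg = segment linked unique p q eq in
      neither⇔ (acyclic⇒¬closingEdge acyclic (walk seg) (Segment.unique seg)
                  (subst (2 ≤_) (sym (length≡ seg)) (s≤s (s≤s z≤n))) ∘ adj-sym G)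
               (λ ())

    adj⇔distance≡1 : ∀ {x y} (p : x ∈ s) (q : y ∈ s) → Adj G x y ⇔ ∣ idx p - idx q ∣ ≡ 1
    adj⇔distance≡1 {x} {y} p q with ≤-total (idx p) (idx q)
    ... | inj₁ p≤q = let d , eq = m≤n⇒∃[o]m+o≡n p≤q in begin
      Adj G x y              ≈⟨ adj⇔gap≡1 p q eq ⟩
      d ≡ 1                  ≡⟨ cong (_≡ 1) (gap≡distance eq) ⟩
      ∣ idx p - idx q ∣ ≡ 1  ∎
      where open ⇔-Reasoning
    ... | inj₂ q≤p = let d , eq = m≤n⇒∃[o]m+o≡n q≤p in begin
      Adj G x y              ≈⟨ adj-sym⇔ ⟩
      Adj G y x              ≈⟨ adj⇔gap≡1 q p eq ⟩
      d ≡ 1                  ≡⟨ cong (_≡ 1) (trans (gap≡distance eq) (∣-∣-comm (idx q) (idx p))) ⟩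
      ∣ idx p - idx q ∣ ≡ 1  ∎
      where open ⇔-Reasoning

    ¬twoAttachments : ∀ {x y z d} → x ∉ s → Adj G x y → Adj G x z →
                      (q : y ∈ s) (p : z ∈ s) → ¬ idx q + suc d ≡ idx p
    ¬twoAttachments x∉s xy xz q p eq =
      let seg = segment linked unique q p eq in
      acyclic⇒¬closingEdge acyclic (xy ∷ walk seg)
        (anti-mono (⊆path seg) (Membership.∉⇒All[≉] (setoid V) x∉s) ∷ Segment.unique seg)
        (s≤s (subst (1 ≤_) (sym (length≡ seg)) (s≤s z≤n)))
        (adj-sym G xz)

    adj⇔sameAttachment : ∀ {x y z} → x ∉ s → (q : y ∈ s) → Adj G x y →
                         (p : z ∈ s) → Adj G x z ⇔ idx q ≡ idx p
    adj⇔sameAttachment {x} x∉s q xy p =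
      mk⇔ sameIndex (λ eq → subst (Adj G x) (idx-injective q p eq) xy)
      where
      sameIndex : Adj G x _ → idx q ≡ idx p
      sameIndex xz with ≤-total (idx q) (idx p)
      ... | inj₁ q≤p with m≤n⇒∃[o]m+o≡n q≤p
      ...   | zero  , eq = trans (sym (+-identityʳ _)) eq
      ...   | suc d , eq = ⊥-elim (¬twoAttachments x∉s xy xz q p eq)
      sameIndex xz | inj₂ p≤q with m≤n⇒∃[o]m+o≡n p≤q
      ...   | zero  , eq = sym (trans (sym (+-identityʳ _)) eq)
      ...   | suc d , eq = ⊥-elim (¬twoAttachments x∉s xz xy p q eq)

    ¬adj-offPath-ordered : ∀ {x y x′ y′ d} → x ∉ s → (q : y ∈ s) → Adj G x y →
                           x′ ∉ s → (q′ : y′ ∈ s) → Adj G x′ y′ → idx q + d ≡ idx q′ → ¬ Adj G x x′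
    ¬adj-offPath-ordered {x} {y} {x′} {y′} {d} x∉s q xy x′∉s q′ x′y′ eq xx′ =
      acyclic⇒¬closingEdge acyclic (adj-sym G xx′ ∷ xy ∷ walk seg)
        ((x′≢x ∷ avoids x′∉s) ∷ avoids x∉s ∷ Segment.unique seg) (s≤s (s≤s z≤n)) (adj-sym G x′y′)
      where
      seg : Segment y y′ s d
      seg = segment linked unique q q′ eq
      avoids : ∀ {v} → v ∉ s → All (v ≢_) (y ∷ inner seg)
      avoids v∉s = anti-mono (⊆path seg) (Membership.∉⇒All[≉] (setoid V) v∉s)
      x′≢x : x′ ≢ x
      x′≢x refl = adj-irrefl G xx′

    ¬adj-offPath : ∀ {x y x′ y′} → x ∉ s → (q : y ∈ s) → Adj G x y →
                   x′ ∉ s → (q′ : y′ ∈ s) → Adj G x′ y′ → ¬ Adj G x x′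
    ¬adj-offPath x∉s q xy x′∉s q′ x′y′ with ≤-total (idx q) (idx q′)
    ... | inj₁ q≤q′ = ¬adj-offPath-ordered x∉s q xy x′∉s q′ x′y′ (proj₂ (m≤n⇒∃[o]m+o≡n q≤q′))
    ... | inj₂ q′≤q =
      ¬adj-offPath-ordered x′∉s q′ x′y′ x∉s q xy (proj₂ (m≤n⇒∃[o]m+o≡n q′≤q)) ∘ adj-sym G

    adj⇔band-placement : ∀ {x y} (px : Placement s x) (py : Placement s y) →
                         Adj G x y ⇔ Band (placementPos px) (placementPos py)
    adj⇔band-placement (onSpine p) (onSpine q) =
      ⇔-trans (adj⇔distance≡1 p q) (⇔-sym (spine-band (idx p) (idx q)))
    adj⇔band-placement (leafOf x∉s q xy) (onSpine p) =
      ⇔-trans (adj⇔sameAttachment x∉s q xy p) (⇔-sym (leaf-spine-band (idx q) (idx p)))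
    adj⇔band-placement {x} {y} (onSpine p) (leafOf y∉s q yx) = begin
      Adj G x y                                  ≈⟨ adj-sym⇔ ⟩
      Adj G y x                                  ≈⟨ adj⇔sameAttachment y∉s q yx p ⟩
      idx q ≡ idx p                              ≈⟨ leaf-spine-band (idx q) (idx p) ⟨
      Band (leafPos (idx q)) (spinePos (idx p))  ≈⟨ band-sym⇔ (leafPos (idx q)) (spinePos (idx p)) ⟩
      Band (spinePos (idx p)) (leafPos (idx q))  ∎
      where open ⇔-Reasoning
    adj⇔band-placement (leafOf x∉s q xy) (leafOf x′∉s q′ x′y′) =
      neither⇔ (¬adj-offPath x∉s q xy x′∉s q′ x′y′) (¬leaf-leaf-band (idx q) (idx q′))

caterpillar-muvi : (G : Graph) → IsCaterpillar G → MUVI G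
caterpillar-muvi G ((_ , acyclic) , s , (linked , unique) , cover) =
  muvi-fromBandLayout G (placementPos G ∘ place)
    (λ x y _ → adj⇔band-placement G acyclic linked unique (place x) (place y))
  where
  place : ∀ x → Placement G s x
  place = placement G cover

-- Cycles

outPos : ℕ → ℕ
outPos m = 9 + m * 12

backPos : ℕ → ℕ
backPos m = 3 + m * 12

-- 9 + 6b beyond the last out vertex outPos k and 15 − 6b beyond the last back vertex
-- backPos (k + b).
turnPos : ℕ → ℕ → ℕ
turnPos k b = 18 + (k * 12 + b * 6)

out-out-band : ∀ m m′ → Band (outPos m) (outPos m′) ⇔ ∣ m - m′ ∣ ≡ 1
out-out-band = band-progression (from-yes (inBand? 12)) 9

back-back-band : ∀ m m′ → Band (backPos m) (backPos m′) ⇔ ∣ m - m′ ∣ ≡ 1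
back-back-band = band-progression (from-yes (inBand? 12)) 3

¬out-back-band : ∀ m m′ → ¬ Band (outPos m) (backPos m′)
¬out-back-band 0       0             = from-no (band? 9 3)
¬out-back-band 0       1             = from-no (band? 9 15)
¬out-back-band 0       (suc (suc _)) = ¬inBand-16+
¬out-back-band (suc _) 0             = ¬inBand-16+
¬out-back-band (suc m) (suc m′)      = ¬out-back-band m m′

out-turn-band : ∀ m k b → b ≤ 1 → m ≤ k → Band (outPos m) (turnPos k b) ⇔ m ≡ k
out-turn-band 0       0       _ z≤n       _   = both⇔ (from-yes (band? 9 18)) refl
out-turn-band 0       0       _ (s≤s z≤n) _   = both⇔ (from-yes (band? 9 24)) refl
out-turn-band 0       (suc k) b _         _   = neither⇔ ¬inBand-16+ (λ ())
out-turn-band (suc m) (suc k) b b≤1 (s≤s m≤k) =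
  ⇔-trans (out-turn-band m k b b≤1 m≤k) (mk⇔ (cong suc) suc-injective)

back-turn-band : ∀ m k b → b ≤ 1 → m ≤ k + b → Band (backPos m) (turnPos k b) ⇔ m ≡ k + b
back-turn-band 0       0       _ z≤n       _   = both⇔ (from-yes (band? 3 18)) refl
back-turn-band 0       0       _ (s≤s z≤n) _   = neither⇔ (from-no (band? 3 24)) (λ ())
back-turn-band 0       (suc k) b _         _   = neither⇔ ¬inBand-16+ (λ ())
back-turn-band 1       0       _ (s≤s z≤n) _   = both⇔ (from-yes (band? 15 24)) refl
back-turn-band (suc (suc m)) 0 _ (s≤s z≤n) (s≤s ())
back-turn-band (suc m) (suc k) b b≤1 (s≤s m≤k) =
  ⇔-trans (back-turn-band m k b b≤1 m≤k) (mk⇔ (cong suc) suc-injective)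

out-home-band : ∀ m → Band (outPos m) 0 ⇔ m ≡ 0
out-home-band 0       = both⇔ (from-yes (band? 9 0)) refl
out-home-band (suc m) = neither⇔ ¬inBand-16+ (λ ())

back-home-band : ∀ m → Band (backPos m) 0 ⇔ m ≡ 1
back-home-band 0             = neither⇔ (from-no (band? 3 0)) (λ ())
back-home-band 1             = both⇔ (from-yes (band? 15 0)) refl
back-home-band (suc (suc m)) = neither⇔ ¬inBand-16+ (λ ())

¬turn-home-band : ∀ k {b} → b ≤ 1 → 1 ≤ k + b → ¬ Band (turnPos k b) 0
¬turn-home-band 0       z≤n       ()
¬turn-home-band 0       (s≤s z≤n) _ = from-no (band? 24 0)
¬turn-home-band (suc k) _         _ = ¬inBand-16+

∣m-n∣≡1⇔ : ∀ m n → ∣ m - n ∣ ≡ 1 ⇔ (n ≡ suc m ⊎ m ≡ suc n)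
∣m-n∣≡1⇔ zero    zero    = neither⇔ (λ ()) [ (λ ()) , (λ ()) ]
∣m-n∣≡1⇔ zero    (suc n) = mk⇔ inj₁ [ id , (λ ()) ]
∣m-n∣≡1⇔ (suc m) zero    = mk⇔ inj₂ [ (λ ()) , id ]
∣m-n∣≡1⇔ (suc m) (suc n) =
  ⇔-trans (∣m-n∣≡1⇔ m n) (mk⇔ (Sum.map (cong suc) (cong suc)) (Sum.map suc-injective suc-injective))

Step : ℕ → ℕ → ℕ → Set
Step n i j = j ≡ suc i ⊎ (i ≡ 0 × suc j ≡ n)

cAdj⇔step : ∀ {n} {a b : Fin n} → toℕ a < toℕ b → CAdj n a b ⇔ Step n (toℕ a) (toℕ b)
cAdj⇔step a<b =
  mk⇔ [ inj₁ , [ ⊥-elim ∘ <-asym a<b ∘ ≤-reflexive ∘ sym , [ inj₂ , ⊥-elim ∘ ¬b≡0 ∘ proj₁ ] ] ]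
      [ inj₁ , inj₂ ∘ inj₂ ∘ inj₁ ]
  where
  ¬b≡0 : toℕ _ ≢ 0
  ¬b≡0 b≡0 = n≮0 (subst (_ <_) b≡0 a<b)

step⇔succ : ∀ {n i j} → suc j ≢ n → Step n i j ⇔ j ≡ suc i
step⇔succ ¬last = mk⇔ [ id , ⊥-elim ∘ ¬last ∘ proj₂ ] inj₁

step⇔succ-or-first : ∀ {n i j} → suc j ≡ n → Step n i j ⇔ (j ≡ suc i ⊎ i ≡ 0)
step⇔succ-or-first last = mk⇔ (Sum.map₂ proj₁) (Sum.map₂ (_, last))

succ⇔distance≡1 : ∀ {i j} → i < j → j ≡ suc i ⇔ ∣ i - j ∣ ≡ 1
succ⇔distance≡1 {i} {j} i<j =
  ⇔-trans (mk⇔ inj₁ [ id , ⊥-elim ∘ <-asym i<j ∘ ≤-reflexive ∘ sym ]) (⇔-sym (∣m-n∣≡1⇔ i j))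

m+n≡o+p⇒∣n-p∣≡∣m-o∣ : ∀ m n o p → m + n ≡ o + p → ∣ n - p ∣ ≡ ∣ m - o ∣
m+n≡o+p⇒∣n-p∣≡∣m-o∣ m n o p eq = begin
  ∣ n - p ∣          ≡⟨ ∣m+n-m+o∣≡∣n-o∣ m n p ⟨
  ∣ m + n - m + p ∣  ≡⟨ cong ∣_- m + p ∣ eq ⟩
  ∣ o + p - m + p ∣  ≡⟨ cong₂ ∣_-_∣ (+-comm o p) (+-comm m p) ⟩
  ∣ p + o - p + m ∣  ≡⟨ ∣m+n-m+o∣≡∣n-o∣ p o m ⟩
  ∣ o - m ∣          ≡⟨ ∣-∣-comm o m ⟩
  ∣ m - o ∣          ∎
  where open ≡-Reasoning

m+n≡m⇔n≡0 : ∀ m {n} → m + n ≡ m ⇔ n ≡ 0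
m+n≡m⇔n≡0 m {n} = mk⇔ (λ eq → +-cancelˡ-≡ m n 0 (trans eq (sym (+-identityʳ m))))
                      (λ { refl → +-identityʳ m })

step⇔distance≡1 : ∀ {n i j} → i < j → suc j ≢ n → Step n i j ⇔ ∣ i - j ∣ ≡ 1
step⇔distance≡1 i<j ¬last = ⇔-trans (step⇔succ ¬last) (succ⇔distance≡1 i<j)

⇔-by-< : ∀ {n} {R S : Fin n → Fin n → Set} → Symmetric R → Symmetric S →
         (∀ {a b} → toℕ a < toℕ b → R a b ⇔ S a b) → ∀ a b → a ≢ b → R a b ⇔ S a b
⇔-by-< symR symS ordered a b a≢b with <-cmp (toℕ a) (toℕ b)
... | tri< a<b _ _ = ordered a<b
... | tri≈ _ a≡b _ = ⊥-elim (a≢b (toℕ-injective a≡b))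
... | tri> _ _ b<a =
  mk⇔ (symS ∘ Equivalence.to (ordered b<a) ∘ symR) (symR ∘ Equivalence.from (ordered b<a) ∘ symS)

-- The vertices 0 … k of the cycle go out along outPos, vertex k + 1 turns, the next k + b
-- come back along backPos and the last one sits at 0.
module CycleLayout (k b : ℕ) (b≤1 : b ≤ 1) (1≤k+b : 1 ≤ k + b) where

  n : ℕ
  n = 3 + (k + (k + b))

  last : ℕ
  last = 2 + k + (k + b)

  data Vertex : ℕ → Set where
    out  : ∀ {i} → i ≤ k → Vertex i
    turn : Vertex (suc k)
    -- t steps after the turn, at backPos (suc m)
    back : ∀ m t → suc m + t ≡ k + b → Vertex (2 + k + t)
    home : Vertex last

  position : ∀ {i} → Vertex i → ℕ
  position {i} (out _)  = outPos i
  position turn         = turnPos k b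
  position (back m _ _) = backPos (suc m)
  position home         = 0

  afterTurn : ∀ t → suc k + suc t ≡ 2 + k + t
  afterTurn t = cong suc (+-suc k t)

  view : ∀ {i} → i < n → Vertex i
  view {i} i<n with i ≤? k
  ... | yes i≤k = out i≤k
  ... | no  i≰k with m≤n⇒∃[o]m+o≡n (≰⇒> i≰k)
  ...   | zero  , refl = subst Vertex (sym (+-identityʳ (suc k))) turn
  ...   | suc t , refl with <-cmp t (k + b)
  ...     | tri< t<K _ _ = let m , e = m≤n⇒∃[o]m+o≡n t<K in
    subst Vertex (sym (afterTurn t)) (back m t (trans (cong suc (+-comm m t)) e))
  ...     | tri≈ _ refl _ = subst Vertex (sym (afterTurn t)) home
  ...     | tri> _ _ K<t  = ⊥-elim (<⇒≱ i<n (subst (n ≤_) (sym (afterTurn t)) (+-monoʳ-< (2 + k) K<t)))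

  ¬last : ∀ {j} → j < last → suc j ≢ n
  ¬last j<last = <⇒≢ j<last ∘ suc-injective

  out<last : ∀ {j} → j ≤ k → j < last
  out<last j≤k = s≤s (m≤n⇒m≤1+n (≤-trans j≤k (m≤m+n k (k + b))))

  turn<last : suc k < last
  turn<last = s≤s (s≤s (m≤m+n k (k + b)))

  back<last : ∀ {m t} → suc m + t ≡ k + b → 2 + k + t < last
  back<last {m} {t} e = +-monoʳ-< (2 + k) (≤-trans (s≤s (m≤n+m t m)) (≤-reflexive e))

  ¬out-succ : ∀ {i} x → i ≤ k → 2 + k + x ≢ suc i
  ¬out-succ x i≤k eq = <⇒≱ (s≤s (m≤m+n k x)) (subst (_≤ k) (sym (suc-injective eq)) i≤k)

  step⇔band : ∀ {i j} (v : Vertex i) (w : Vertex j) → i < j → j < n →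
              Step n i j ⇔ Band (position v) (position w)
  step⇔band (out {i} i≤k) (out {j} j≤k) i<j _ = begin
    Step n i j                  ≈⟨ step⇔distance≡1 i<j (¬last (out<last j≤k)) ⟩
    ∣ i - j ∣ ≡ 1               ≈⟨ out-out-band i j ⟨
    Band (outPos i) (outPos j)  ∎
    where open ⇔-Reasoning
  step⇔band (out {i} i≤k) turn _ _ = begin
    Step n i (suc k)               ≈⟨ step⇔succ (¬last turn<last) ⟩
    suc k ≡ suc i                  ≈⟨ mk⇔ (sym ∘ suc-injective) (cong suc ∘ sym) ⟩
    i ≡ k                          ≈⟨ out-turn-band i k b b≤1 i≤k ⟨
    Band (outPos i) (turnPos k b)  ∎
    where open ⇔-Reasoning
  step⇔band (out {i} i≤k) (back m t e) _ _ =
    neither⇔ (¬out-succ t i≤k ∘ Equivalence.to (step⇔succ (¬last (back<last e))))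
             (¬out-back-band i (suc m))
  step⇔band (out {i} i≤k) home _ _ = begin
    Step n i last             ≈⟨ step⇔succ-or-first refl ⟩
    (last ≡ suc i ⊎ i ≡ 0)    ≈⟨ mk⇔ [ ⊥-elim ∘ ¬out-succ (k + b) i≤k , id ] inj₂ ⟩
    i ≡ 0                     ≈⟨ out-home-band i ⟨
    Band (outPos i) 0         ∎
    where open ⇔-Reasoning
  step⇔band turn (back m t e) _ _ = begin
    Step n (suc k) (2 + k + t)            ≈⟨ step⇔succ (¬last (back<last e)) ⟩
    2 + k + t ≡ 2 + k                     ≈⟨ m+n≡m⇔n≡0 (2 + k) ⟩
    t ≡ 0                                 ≈⟨ m+n≡m⇔n≡0 (suc m) ⟨
    suc m + t ≡ suc m                     ≈⟨ mk⇔ (λ eq → trans (sym eq) e) (trans e ∘ sym) ⟩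
    suc m ≡ k + b                         ≈⟨ back-turn-band (suc m) k b b≤1 m≤K ⟨
    Band (backPos (suc m)) (turnPos k b)  ≈⟨ band-sym⇔ (backPos (suc m)) (turnPos k b) ⟩
    Band (turnPos k b) (backPos (suc m))  ∎
    where
    open ⇔-Reasoning
    m≤K : suc m ≤ k + b
    m≤K = ≤-trans (m≤m+n (suc m) t) (≤-reflexive e)
  step⇔band turn home _ _ =
    neither⇔ [ ¬K≡0 ∘ Equivalence.to (m+n≡m⇔n≡0 (2 + k)) , (λ ()) ∘ proj₁ ]
             (¬turn-home-band k b≤1 1≤k+b)
    where
    ¬K≡0 : k + b ≢ 0
    ¬K≡0 = <⇒≢ 1≤k+b ∘ sym
  step⇔band (back m t e) (back m′ t′ e′) i<j _ = begin
    Step n (2 + k + t) (2 + k + t′)            ≈⟨ step⇔distance≡1 i<j (¬last (back<last e′)) ⟩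
    ∣ 2 + k + t - 2 + k + t′ ∣ ≡ 1             ≡⟨ cong (_≡ 1) (∣m+n-m+o∣≡∣n-o∣ (2 + k) t t′) ⟩
    ∣ t - t′ ∣ ≡ 1                             ≡⟨ cong (_≡ 1) sameLevelGap ⟩
    ∣ m - m′ ∣ ≡ 1                             ≈⟨ back-back-band (suc m) (suc m′) ⟨
    Band (backPos (suc m)) (backPos (suc m′))  ∎
    where
    open ⇔-Reasoning
    sameLevelGap : ∣ t - t′ ∣ ≡ ∣ m - m′ ∣
    sameLevelGap = m+n≡o+p⇒∣n-p∣≡∣m-o∣ (suc m) t (suc m′) t′ (trans e (sym e′))
  step⇔band (back m t e) home i<j _ = begin
    Step n (2 + k + t) last                      ≈⟨ step⇔succ-or-first refl ⟩
    (last ≡ suc (2 + k + t) ⊎ 2 + k + t ≡ 0)     ≈⟨ mk⇔ [ id , (λ ()) ] inj₁ ⟩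
    last ≡ suc (2 + k + t)                       ≈⟨ succ⇔distance≡1 i<j ⟩
    ∣ 2 + k + t - last ∣ ≡ 1                     ≡⟨ cong (_≡ 1) (∣m+n-m+o∣≡∣n-o∣ (2 + k) t (k + b)) ⟩
    ∣ t - (k + b) ∣ ≡ 1                          ≡⟨ cong (_≡ 1) (m+n≡o+p⇒∣n-p∣≡∣m-o∣ (suc m) t 0 _ e) ⟩
    suc m ≡ 1                                    ≈⟨ back-home-band (suc m) ⟨
    Band (backPos (suc m)) 0                     ∎
    where open ⇔-Reasoning
  step⇔band turn         (out j≤k) i<j _   = ⊥-elim (<⇒≱ i<j (m≤n⇒m≤1+n j≤k))
  step⇔band turn         turn      i<j _   = ⊥-elim (<-irrefl refl i<j)
  step⇔band (back _ t _) (out j≤k) i<j _   =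
    ⊥-elim (<⇒≱ i<j (m≤n⇒m≤1+n (m≤n⇒m≤1+n (≤-trans j≤k (m≤m+n k t)))))
  step⇔band (back _ t _) turn      i<j _   = ⊥-elim (<⇒≱ i<j (s≤s (m≤n⇒m≤1+n (m≤m+n k t))))
  step⇔band home         _         i<j j<n = ⊥-elim (<⇒≱ j<n i<j)

  cycleLayout-muvi : (h3 : 3 ≤ n) → MUVI (C n h3)
  cycleLayout-muvi h3 =
    muvi-fromBandLayout (C n h3) pos (⇔-by-< (adj-sym (C n h3)) (λ {a} → band-sym {pos a}) ordered)
    where
    pos : Fin n → ℕ
    pos a = position (view (toℕ<n a))
    ordered : ∀ {a c : Fin n} → toℕ a < toℕ c → CAdj n a c ⇔ Band (pos a) (pos c)
    ordered {a} {c} a<c =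
      ⇔-trans (cAdj⇔step a<c) (step⇔band (view (toℕ<n a)) (view (toℕ<n c)) a<c (toℕ<n c))

halve : ∀ x → ∃₂ λ k b → b ≤ 1 × x ≡ k + (k + b)
halve 0 = 0 , 0 , z≤n , refl
halve 1 = 0 , 1 , s≤s z≤n , refl
halve (suc (suc x)) with halve x
... | k , b , b≤1 , refl = suc k , b , b≤1 , cong suc (sym (+-suc k (k + b)))

1≤k+[k+b]⇒1≤k+b : ∀ k b → 1 ≤ k + (k + b) → 1 ≤ k + b
1≤k+[k+b]⇒1≤k+b zero    b 1≤b = 1≤b
1≤k+[k+b]⇒1≤k+b (suc k) b _   = s≤s z≤n

cycle-muvi : (n : ℕ) (h3 : 3 ≤ n) → 4 ≤ n → MUVI (C n h3)
cycle-muvi (suc (suc (suc x))) h3 (s≤s (s≤s (s≤s 1≤x))) with halve x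
... | k , b , b≤1 , refl = CycleLayout.cycleLayout-muvi k b b≤1 (1≤k+[k+b]⇒1≤k+b k b 1≤x) h3

theorem14 :
    ((m n : ℕ) → 1 ≤ m → 1 ≤ n → MUVI (K m n)) ×
    ((G : Graph) → IsCaterpillar G → MUVI G) ×
    ((n : ℕ) (h3 : 3 ≤ n) → 4 ≤ n → MUVI (C n h3))
theorem14 = (λ m n _ _ → completeBipartite-muvi m n) , caterpillar-muvi , cycle-muvi
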